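{- Let $G$ be a finite simple $2$-connected $k$-regular graph, where $k \geq 3$. Then every edge of $G$ is contained in a cycle of even length.
   Context: Graphs are finite, simple (no loops, no multiple edges). A graph is $k$-regular if every vertex has degree $k$. A graph is $2$-connected if it has more than $2$ vertices and remains connected whenever fewer than $2$ vertices are removed. The length of a cycle is its number of edges. -}

module Defs where

open import Level using (0ℓ)
open import Data.Nat using (ℕ; zero; suc; _+_; _*_; _≤_; _<_)
open import Data.Fin using (Fin)
open import Data.List using (List; []; _∷_; length; filter)
open import Data.List.Relation.Unary.Unique.Propositional using (Unique)
open import Data.List.Membership.Propositional using (_∈_; _∉_)
open import Data.Product using (Σ; ∃; _×_; _,_)
open import Data.Sum using (_⊎_)
open import Data.Empty using (⊥)
open import Relation.Nullary using (¬_; Dec)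
open import Relation.Unary using (Pred)
open import Relation.Binary.PropositionalEquality using (_≡_; _≢_)
open import Data.Vec.Functional using (Vector)
open import Data.List using (allFin) public

record Graph (n : ℕ) : Set₁ where
  field
    Adj     : Fin n → Fin n → Set
    adj?    : ∀ u v → Dec (Adj u v)
    sym     : ∀ {u v} → Adj u v → Adj v u
    irrefl  : ∀ {u} → ¬ Adj u u

open Graph public

neighbours : ∀ {n} (G : Graph n) → Fin n → List (Fin n)
neighbours G v = filter (adj? G v) (allFin _)

degree : ∀ {n} (G : Graph n) → Fin n → ℕ
degree G v = length (neighbours G v)

Regular : ∀ {n} → Graph n → ℕ → Set
Regular G k = ∀ v → degree G v ≡ k

data WalkIn {n} (G : Graph n) (P : Fin n → Set) : Fin n → Fin n → Set where
  here  : ∀ {u} → P u → WalkIn G P u u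
  step  : ∀ {u w v} → P u → Adj G u w → WalkIn G P w v → WalkIn G P u v

Connected : ∀ {n} → Graph n → Set
Connected G = ∀ u v → WalkIn G (λ _ → Data.Unit.⊤) u v
  where import Data.Unit

ConnectedWithout : ∀ {n} → Graph n → Fin n → Set
ConnectedWithout G x = ∀ u v → u ≢ x → v ≢ x → WalkIn G (λ w → w ≢ x) u v

TwoConnected : ∀ {n} → Graph n → Set
TwoConnected {n} G = (2 < n) × Connected G × (∀ x → ConnectedWithout G x)

data Path {n} (G : Graph n) : List (Fin n) → Set where
  single : ∀ {v} → Path G (v ∷ [])
  cons   : ∀ {u v vs} → Adj G u v → Path G (v ∷ vs) → Path G (u ∷ v ∷ vs)

last : ∀ {A : Set} → A → List A → A
last a []       = a
last a (b ∷ bs) = last b bs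

-- A cycle: a list of m ≥ 3 distinct vertices v₀ … v_{m-1}, with
-- consecutive vertices adjacent and v_{m-1} adjacent to v₀.
-- Its length (number of edges) is m.
record Cycle {n} (G : Graph n) : Set where
  constructor mkCycle
  field
    start    : Fin n
    rest     : List (Fin n)
    distinct : Unique (start ∷ rest)
    long     : 3 ≤ length (start ∷ rest)
    path     : Path G (start ∷ rest)
    closing  : Adj G (last start rest) start

open Cycle public

cycleLength : ∀ {n} {G : Graph n} → Cycle G → ℕ
cycleLength C = length (start C ∷ rest C)

data Consecutive {A : Set} (u v : A) : List A → Set where
  now   : ∀ {xs} → Consecutive u v (u ∷ v ∷ xs)
  later : ∀ {x xs} → Consecutive u v xs → Consecutive u v (x ∷ xs)

EdgeOf : ∀ {n} {G : Graph n} → Fin n → Fin n → Cycle G → Set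
EdgeOf u v C =
  let vs = start C ∷ rest C
      e : Fin _ → Fin _ → Set
      e a b = Consecutive a b vs ⊎ (a ≡ last (start C) (rest C) × b ≡ start C)
  in e u v ⊎ e v u

Even : ℕ → Set
Even m = ∃ λ j → m ≡ j + j

-- Fix an edge uv. As G − u is connected, colour every w ≠ u by the parity of the number of
-- vertices of a chosen path from v to w avoiding u. If a neighbour x ≠ v of u has an odd such
-- path, closing it through u gives an even cycle through uv. If some edge xy of G − u joins two
-- vertices of the same colour, the paths to x and y together with xy contain an odd cycle
-- reachable from v by a path (a lollipop) avoiding u. Since G − root is connected, some path
-- leaves u or the stem and first meets the odd cycle at b ≠ root; the two arcs from root to b
-- have lengths of opposite parity, so choosing the right arc yields either an even cycle
-- through uv or a lollipop with a shorter stem. Otherwise G − u is properly 2-coloured with v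
-- the only neighbour of u of odd colour; counting the edges between the two colour classes
-- from both sides gives k · (|odd class| + 1) = k · |even class| + 2, so k divides 2.
module Submission where

open import Defs hiding (sym; last; Connected; start; rest; distinct; long; path; closing)
open import Data.Empty using (⊥-elim)
open import Data.Fin using (Fin; zero; suc; _≟_)
open import Data.Fin.Properties using (suc-injective; any?)
open import Data.List using (List; []; _∷_; _++_; [_]; length; reverse; head; last; filter; tabulate)
open import Data.List.Properties
  using (++-assoc; ++-identityʳ; unfold-reverse; reverse-++; reverse-involutive; length-++; length-reverse)
open import Data.List.Membership.Propositional using (_∈_; _∉_)
open import Data.List.Membership.Propositional.Properties using (∈-++⁺ˡ; ∈-++⁺ʳ; ∈-++⁻; ∈-∃++)
open import Data.List.Relation.Binary.Disjoint.Propositional using (Disjoint)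
open import Data.List.Relation.Binary.Subset.Propositional using (_⊆_)
import Data.List.Relation.Binary.Subset.Propositional.Properties as ⊆ₚ
open import Data.List.Relation.Unary.All as All using (All; []; _∷_)
import Data.List.Relation.Unary.All.Properties as Allₚ
open import Data.List.Relation.Unary.AllPairs using ([]; _∷_)
open import Data.List.Relation.Unary.Any as Any using (Any; here; there)
open import Data.List.Relation.Unary.Any.Properties using (reverse⁻)
open import Data.List.Relation.Unary.First as First using (First; _∷_)
open import Data.List.Relation.Unary.First.Properties using (toView)
open import Data.List.Relation.Unary.Linked as Linked using (Linked; []; [-]; _∷_)
import Data.List.Relation.Unary.Linked.Properties as Linked
open import Data.List.Relation.Unary.Unique.Propositional using (Unique)
import Data.List.Relation.Unary.Unique.Propositional.Properties as Unique
open import Data.Maybe using (just)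
open import Data.Maybe.Properties using (just-injective)
open import Data.Maybe.Relation.Binary.Connected as Connected using (Connected; just)
open import Data.Nat using (ℕ; zero; suc; _+_; _*_; _≤_; _<_; s≤s; z≤n; parity)
open import Data.Nat.Divisibility using (_∣_; n∣m*n; ∣m+n∣m⇒∣n; ∣⇒≤)
open import Data.Nat.Induction using (<-wellFounded)
open import Data.Nat.Properties
  using (+-*-semiring; +-suc; +-comm; m≤n+m; +-monoʳ-<; ≤-trans; *-identityˡ; *-zeroʳ; *-distribʳ-+; *-distribˡ-+)
open import Data.Nat.Tactic.RingSolver using (solve-∀)
open import Algebra.Properties.Semiring.Sum +-*-semiring
  using (sum; sum-cong-≗; sum-replicate-zero; ∑-comm; ∑-distrib-+; *-distribˡ-sum; *-distribʳ-sum)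
open import Data.Parity.Base as ℙ using (Parity; 0ℙ; 1ℙ; _⁻¹)
open import Data.Parity.Properties using (+-homo-+; p+p≡0ℙ; p≢p⁻¹) renaming (_≟_ to _ℙ≟_)
open import Data.Product using (Σ; ∃; _×_; _,_; proj₁; proj₂)
open import Data.Sum using (_⊎_; inj₁; inj₂)
open import Function using (_∘_; id)
open import Induction.WellFounded using (Acc; acc)
open import Level using (0ℓ)
open import Relation.Binary.Definitions using (Symmetric)
open import Relation.Binary.PropositionalEquality
  using (_≡_; _≢_; refl; sym; trans; cong; cong₂; subst; module ≡-Reasoning)
open import Relation.Nullary using (¬_; Dec; yes; no)
open import Relation.Nullary.Decidable using (_×-dec_; ¬?)
open import Relation.Unary using (Pred; Decidable; ∁)


parity≡0ℙ⇒Even : ∀ m → parity m ≡ 0ℙ → Even m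
parity≡0ℙ⇒Even zero          _ = 0 , refl
parity≡0ℙ⇒Even (suc (suc m)) p with parity≡0ℙ⇒Even m p
... | j , refl = suc j , cong suc (sym (+-suc j j))

parity-suc : ∀ m → parity (suc m) ≡ parity m ⁻¹
parity-suc zero          = refl
parity-suc (suc zero)    = refl
parity-suc (suc (suc m)) = parity-suc m

parity-+≡1ℙ : ∀ m n → parity (m + n) ≡ 1ℙ → parity m ≡ 1ℙ ⊎ parity n ≡ 1ℙ
parity-+≡1ℙ m n odd with parity m | parity n | trans (sym (+-homo-+ m n)) odd
... | 1ℙ | _ | _    = inj₁ refl
... | 0ℙ | _ | odd′ = inj₂ odd′

p+q+q≡p : ∀ p q → p ℙ.+ q ℙ.+ q ≡ p
p+q+q≡p 0ℙ 0ℙ = refl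
p+q+q≡p 0ℙ 1ℙ = refl
p+q+q≡p 1ℙ 0ℙ = refl
p+q+q≡p 1ℙ 1ℙ = refl

other-parity : ∀ p q r → p ℙ.+ q ≡ 1ℙ → p ≢ r → q ≡ r
other-parity 0ℙ 1ℙ 1ℙ _  _   = refl
other-parity 1ℙ 0ℙ 0ℙ _  _   = refl
other-parity 0ℙ 1ℙ 0ℙ _  p≢r = ⊥-elim (p≢r refl)
other-parity 1ℙ 0ℙ 1ℙ _  p≢r = ⊥-elim (p≢r refl)
other-parity 0ℙ 0ℙ _  () _
other-parity 1ℙ 1ℙ _  () _

≢⇒≡⁻¹ : ∀ {p q} → q ≢ p → q ≡ p ⁻¹
≢⇒≡⁻¹ {0ℙ} {0ℙ} q≢p = ⊥-elim (q≢p refl)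
≢⇒≡⁻¹ {0ℙ} {1ℙ} _   = refl
≢⇒≡⁻¹ {1ℙ} {0ℙ} _   = refl
≢⇒≡⁻¹ {1ℙ} {1ℙ} q≢p = ⊥-elim (q≢p refl)

module _ {A : Set} where

  last-++ : ∀ (xs : List A) {y} ys → last (xs ++ y ∷ ys) ≡ last (y ∷ ys)
  last-++ []                ys = refl
  last-++ (x ∷ [])          ys = refl
  last-++ (x ∷ xs@(_ ∷ _))  ys = last-++ xs ys

  last-reverse : ∀ (xs : List A) → last (reverse xs) ≡ head xs
  last-reverse []       = refl
  last-reverse (x ∷ xs) rewrite unfold-reverse x xs = last-++ (reverse xs) []

  head-reverse : ∀ (xs : List A) → head (reverse xs) ≡ last xs
  head-reverse xs =
    trans (sym (last-reverse (reverse xs))) (cong last (reverse-involutive xs))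

  head-++-∷ : ∀ (xs : List A) {y} ys zs → head (xs ++ y ∷ ys) ≡ head (xs ++ y ∷ zs)
  head-++-∷ []      _ _ = refl
  head-++-∷ (_ ∷ _) _ _ = refl

  ∈-last : ∀ (xs : List A) {z} → last xs ≡ just z → z ∈ xs
  ∈-last (x ∷ [])         refl = here refl
  ∈-last (x ∷ xs@(_ ∷ _)) eq   = there (∈-last xs eq)

  ∈-last-∷ : ∀ {x y} (xs : List A) → last (x ∷ xs) ≡ just y → y ≢ x → y ∈ xs
  ∈-last-∷ []            refl y≢x = ⊥-elim (y≢x refl)
  ∈-last-∷ xs@(_ ∷ _)    eq   _   = ∈-last xs eq

  prefix-⊆ : ∀ (xs : List A) {y} ys → xs ++ [ y ] ⊆ xs ++ y ∷ ys
  prefix-⊆ xs {y} ys x∈ = subst (_ ∈_) (++-assoc xs [ y ] ys) (∈-++⁺ˡ x∈)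

  length-prefix< : ∀ (xs : List A) {y t} ys → last (xs ++ y ∷ ys) ≡ just t → y ≢ t →
                   length (xs ++ [ y ]) < length (xs ++ y ∷ ys)
  length-prefix< xs {y} [] last≡ y≢t = ⊥-elim (y≢t (just-injective (trans (sym (last-++ xs [])) last≡)))
  length-prefix< xs {y} (z ∷ zs) _ _ rewrite length-++ xs {[ y ]} | length-++ xs {y ∷ z ∷ zs} =
    +-monoʳ-< (length xs) (s≤s (s≤s z≤n))

  length-suffix< : ∀ (x : A) xs ys → length ys < length (x ∷ xs ++ ys)
  length-suffix< x xs ys = s≤s (subst (length ys ≤_) (sym (length-++ xs)) (m≤n+m (length ys) (length xs)))

  0<length-++-∷ : ∀ (xs : List A) {y ys} → 0 < length (xs ++ y ∷ ys)
  0<length-++-∷ []       = s≤s z≤n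
  0<length-++-∷ (_ ∷ xs) = s≤s z≤n

  meeting-length : ∀ (h w : A) a₁ a₂ b₁ b₂ →
    length (h ∷ a₁ ++ w ∷ a₂) + length (h ∷ b₁ ++ w ∷ b₂) ≡
    length (h ∷ a₁ ++ w ∷ reverse b₁) + (length (w ∷ a₂) + length (w ∷ b₂))
  meeting-length h w a₁ a₂ b₁ b₂
    rewrite length-++ a₁ {w ∷ a₂} | length-++ b₁ {w ∷ b₂} | length-++ a₁ {w ∷ reverse b₁}
          | length-reverse b₁ = shuffle (length a₁) (length a₂) (length b₁) (length b₂)
    where
    shuffle : ∀ a c b d → suc (a + suc c) + suc (b + suc d) ≡ suc (a + suc b) + (suc c + suc d)
    shuffle = solve-∀

  split-length : ∀ (xs : List A) {y} ys m →
    (length (xs ++ [ y ]) + m) + length (y ∷ ys) ≡ suc (length (xs ++ y ∷ ys) + m)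
  split-length xs {y} ys m rewrite length-++ xs {[ y ]} | length-++ xs {y ∷ ys} =
    shuffle (length xs) (length ys) m
    where
    shuffle : ∀ a b c → (a + 1 + c) + suc b ≡ suc (a + suc b + c)
    shuffle = solve-∀

  arc-length : ∀ (xs ys zs : List A) {y} →
    length ((xs ++ ys) ++ y ∷ reverse zs) ≡ suc (length ys + (length xs + length zs))
  arc-length xs ys zs {y} rewrite length-++ (xs ++ ys) {y ∷ reverse zs} | length-++ xs {ys}
                                | length-reverse zs = shuffle (length xs) (length ys) (length zs)
    where
    shuffle : ∀ a b c → a + b + suc c ≡ suc (b + (a + c))
    shuffle = solve-∀

  ∉⇒All≢ : ∀ {x} (xs : List A) → x ∉ xs → All (x ≢_) xs
  ∉⇒All≢ []       _   = []
  ∉⇒All≢ (y ∷ ys) x∉ = (λ x≡y → x∉ (here x≡y)) ∷ ∉⇒All≢ ys (λ x∈ys → x∉ (there x∈ys))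

  unique-∷⇒∉ : ∀ {x} {xs : List A} → Unique (x ∷ xs) → x ∉ xs
  unique-∷⇒∉ (x∉ ∷ _) x∈ = All.lookup x∉ x∈ refl

  unique-++⁻ˡ : ∀ (xs : List A) {ys} → Unique (xs ++ ys) → Unique xs
  unique-++⁻ˡ []       _        = []
  unique-++⁻ˡ (x ∷ xs) (x∉ ∷ u) = Allₚ.++⁻ˡ xs x∉ ∷ unique-++⁻ˡ xs u

  unique-++⁻ʳ : ∀ (xs : List A) {ys} → Unique (xs ++ ys) → Unique ys
  unique-++⁻ʳ []       u       = u
  unique-++⁻ʳ (x ∷ xs) (_ ∷ u) = unique-++⁻ʳ xs u

  unique-++⇒disjoint : ∀ (xs : List A) {ys} → Unique (xs ++ ys) → Disjoint xs ys
  unique-++⇒disjoint (x ∷ xs) (x∉ ∷ u) (here refl , z∈ys) =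
    All.lookup (Allₚ.++⁻ʳ xs x∉) z∈ys refl
  unique-++⇒disjoint (x ∷ xs) (_ ∷ u) (there z∈xs , z∈ys) =
    unique-++⇒disjoint xs u (z∈xs , z∈ys)

  unique⇒prefix∩suffix : ∀ (xs : List A) {y ys} → Unique (xs ++ y ∷ ys) → Disjoint (xs ++ [ y ]) ys
  unique⇒prefix∩suffix xs {y} {ys} u =
    unique-++⇒disjoint (xs ++ [ y ]) (subst Unique (sym (++-assoc xs [ y ] ys)) u)

  unique-reverse : ∀ {xs : List A} → Unique xs → Unique (reverse xs)
  unique-reverse {[]}     _        = []
  unique-reverse {x ∷ xs} (x∉ ∷ u) rewrite unfold-reverse x xs =
    Unique.++⁺ (unique-reverse u) ([] ∷ [])
      λ { (x∈ , here refl) → All.lookup x∉ (reverse⁻ x∈) refl }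

  disjoint-⊆ : ∀ {xs xs′ ys ys′ : List A} → xs ⊆ xs′ → ys ⊆ ys′ → Disjoint xs′ ys′ → Disjoint xs ys
  disjoint-⊆ xs⊆ ys⊆ d (x∈xs , x∈ys) = d (xs⊆ x∈xs , ys⊆ x∈ys)

  disjoint-++ : ∀ xs {ys zs : List A} → Disjoint xs zs → Disjoint ys zs → Disjoint (xs ++ ys) zs
  disjoint-++ xs dx dy (x∈ , x∈zs) with ∈-++⁻ xs x∈
  ... | inj₁ x∈xs = dx (x∈xs , x∈zs)
  ... | inj₂ x∈ys = dy (x∈ys , x∈zs)

  module _ {R : A → A → Set} where

    linked-++⁻ˡ : ∀ (xs : List A) {ys} → Linked R (xs ++ ys) → Linked R xs
    linked-++⁻ˡ []               _       = []
    linked-++⁻ˡ (x ∷ [])         _       = [-]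
    linked-++⁻ˡ (x ∷ xs@(_ ∷ _)) (r ∷ l) = r ∷ linked-++⁻ˡ xs l

    linked-++⁻ʳ : ∀ (xs : List A) {ys} → Linked R (xs ++ ys) → Linked R ys
    linked-++⁻ʳ []       l = l
    linked-++⁻ʳ (x ∷ xs) l = linked-++⁻ʳ xs (Linked.tail l)

    linked-reverse : Symmetric R → ∀ {xs} → Linked R xs → Linked R (reverse xs)
    linked-reverse R-sym {[]}     _ = []
    linked-reverse R-sym {x ∷ xs} l rewrite unfold-reverse x xs =
      Linked.++⁺ (linked-reverse R-sym (Linked.tail l)) connect [-]
      where
      connect : Connected R (last (reverse xs)) (just x)
      connect = subst (λ m → Connected R m (just x)) (sym (last-reverse xs))
                  (Connected.sym R-sym (Linked.head′ l))

  Any⇒First : ∀ {T : Pred A 0ℓ} → Decidable T → ∀ {xs} → Any T xs → First (∁ T) T xs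
  Any⇒First T? {x ∷ xs} t∈ with T? x
  ... | yes tx = First.[ tx ]
  ... | no ¬tx = ¬tx ∷ Any⇒First T? (Any.tail ¬tx t∈)

  record Bridge (S T : Pred A 0ℓ) (xs : List A) : Set where
    field
      pre mid post : List A
      from to      : A
      split        : xs ≡ pre ++ from ∷ mid ++ to ∷ post
      from∈S       : S from
      to∈T         : T to
      mid-avoids   : All (λ x → ¬ S x × ¬ T x) mid

  module _ {S T : Pred A 0ℓ} (S? : Decidable S) (T? : Decidable T) where

    private
      prepend : ∀ {x xs} → Bridge S T xs → Bridge S T (x ∷ xs)
      prepend {x} b = record
        { pre = x ∷ pre ; mid = mid ; post = post ; from = from ; to = to
        ; split = cong (x ∷_) split ; from∈S = from∈S ; to∈T = to∈T ; mid-avoids = mid-avoids }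
        where open Bridge b

      skip : ∀ {z y ys} → ¬ S y → ¬ T y → Bridge S T (z ∷ ys) → Bridge S T (z ∷ y ∷ ys)
      skip {y = y} ¬sy ¬ty record
        { pre = [] ; mid = mid ; post = post ; split = refl ; from∈S = s ; to∈T = t ; mid-avoids = m }
        = record
        { pre = [] ; mid = y ∷ mid ; post = post
        ; split = refl ; from∈S = s ; to∈T = t ; mid-avoids = (¬sy , ¬ty) ∷ m }
      skip {y = y} ¬sy ¬ty record
        { pre = z ∷ pre ; mid = mid ; post = post ; split = refl ; from∈S = s ; to∈T = t ; mid-avoids = m }
        = record
        { pre = z ∷ y ∷ pre ; mid = mid ; post = post
        ; split = refl ; from∈S = s ; to∈T = t ; mid-avoids = m }

    bridge : ∀ {z xs} → S z → Any T xs → Bridge S T (z ∷ xs)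
    bridge {z} {y ∷ ys} sz t∈ with T? y | S? y
    ... | yes ty | _      = record
      { pre = [] ; mid = [] ; post = ys ; split = refl ; from∈S = sz ; to∈T = ty ; mid-avoids = [] }
    ... | no ¬ty | yes sy = prepend (bridge sy (Any.tail ¬ty t∈))
    ... | no ¬ty | no ¬sy = skip ¬sy ¬ty (bridge sz (Any.tail ¬ty t∈))

𝟙 : ∀ {P : Set} → Dec P → ℕ
𝟙 (yes _) = 1
𝟙 (no _)  = 0

length-filter-tabulate : ∀ {n} {A : Set} {P : A → Set} (P? : Decidable P) (f : Fin n → A) →
                         length (filter P? (tabulate f)) ≡ sum (λ i → 𝟙 (P? (f i)))
length-filter-tabulate {zero}  P? f = refl
length-filter-tabulate {suc n} P? f with P? (f zero)
... | yes _ = cong suc (length-filter-tabulate P? (f ∘ suc))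
... | no  _ = length-filter-tabulate P? (f ∘ suc)

∑-pick : ∀ {n} (i : Fin n) (f g : Fin n → ℕ) → g i ≡ 0 → (∀ j → j ≢ i → f j ≡ g j) →
         sum f ≡ f i + sum g
∑-pick zero f g gi≡0 f≗g = cong (f zero +_)
  (trans (sum-cong-≗ (λ j → f≗g (suc j) λ ())) (cong (_+ sum (g ∘ suc)) (sym gi≡0)))
∑-pick (suc i) f g gi≡0 f≗g = begin
  f zero + sum (f ∘ suc)
    ≡⟨ cong (f zero +_) (∑-pick i (f ∘ suc) (g ∘ suc) gi≡0 (λ j j≢i → f≗g (suc j) (j≢i ∘ suc-injective))) ⟩
  f zero + (f (suc i) + sum (g ∘ suc))
    ≡⟨ swap (f zero) (f (suc i)) (sum (g ∘ suc)) ⟩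
  f (suc i) + (f zero + sum (g ∘ suc))
    ≡⟨ cong (λ m → f (suc i) + (m + sum (g ∘ suc))) (f≗g zero λ ()) ⟩
  f (suc i) + sum g ∎
  where
  open ≡-Reasoning
  swap : ∀ a b c → a + (b + c) ≡ b + (a + c)
  swap = solve-∀

adj⇒≢ : ∀ {n} (G : Graph n) {x y} → Adj G x y → x ≢ y
adj⇒≢ G x~y refl = Graph.irrefl G x~y

module Paths {n} (G : Graph n) where

  open import Data.List.Membership.DecPropositional (_≟_ {n}) using (_∈?_)

  record IsPath (s t : Fin n) (xs : List (Fin n)) : Set where
    field
      linked : Linked (Adj G) xs
      unique : Unique xs
      head≡  : head xs ≡ just s
      last≡  : last xs ≡ just t

  open IsPath public

  singletonPath : ∀ s → IsPath s s [ s ]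
  singletonPath s = record { linked = [-] ; unique = [] ∷ [] ; head≡ = refl ; last≡ = refl }

  consPath : ∀ {s x t xs} → Adj G s x → s ∉ xs → IsPath x t xs → IsPath s t (s ∷ xs)
  consPath {s} {xs = y ∷ ys} s~x s∉ p with head≡ p
  ... | refl = record
    { linked = s~x ∷ linked p
    ; unique = ∉⇒All≢ (y ∷ ys) s∉ ∷ unique p
    ; head≡  = refl
    ; last≡  = last≡ p
    }

  glue : ∀ {s w t xs ys} → IsPath s w xs → IsPath w t (w ∷ ys) → Disjoint xs ys →
         IsPath s t (xs ++ ys)
  glue {s} {w} {t} {x ∷ xs} {ys} p q xs∩ys = record
    { linked = Linked.++⁺ (linked p) connect (Linked.tail (linked q))
    ; unique = Unique.++⁺ (unique p) (unique-++⁻ʳ (w ∷ []) (unique q)) xs∩ys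
    ; head≡  = head≡ p
    ; last≡  = ends ys (last≡ q)
    }
    where
    connect : Connected (Adj G) (last (x ∷ xs)) (head ys)
    connect = subst (λ m → Connected (Adj G) m (head ys)) (sym (last≡ p)) (Linked.head′ (linked q))
    ends : ∀ ys → last (w ∷ ys) ≡ just t → last ((x ∷ xs) ++ ys) ≡ just t
    ends []       w≡t = trans (cong last (++-identityʳ (x ∷ xs))) (trans (last≡ p) w≡t)
    ends (y ∷ ys) eq  = trans (last-++ (x ∷ xs) ys) eq

  reversePath : ∀ {s t xs} → IsPath s t xs → IsPath t s (reverse xs)
  reversePath {xs = xs} p = record
    { linked = linked-reverse (Graph.sym G) (linked p)
    ; unique = unique-reverse (unique p)
    ; head≡  = trans (head-reverse xs) (last≡ p)
    ; last≡  = trans (last-reverse xs) (head≡ p)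
    }

  prefixPath : ∀ {s t w} xs {ys} → IsPath s t (xs ++ w ∷ ys) → IsPath s w (xs ++ [ w ])
  prefixPath {w = w} xs {ys} p = record
    { linked = linked-++⁻ˡ (xs ++ [ w ]) (subst (Linked (Adj G)) split (linked p))
    ; unique = unique-++⁻ˡ (xs ++ [ w ]) (subst Unique split (unique p))
    ; head≡  = trans (head-++-∷ xs [] ys) (head≡ p)
    ; last≡  = last-++ xs []
    }
    where
    split : xs ++ w ∷ ys ≡ (xs ++ [ w ]) ++ ys
    split = sym (++-assoc xs [ w ] ys)

  suffixPath : ∀ {s t w} xs {ys} → IsPath s t (xs ++ w ∷ ys) → IsPath w t (w ∷ ys)
  suffixPath xs {ys} p = record
    { linked = linked-++⁻ʳ xs (linked p)
    ; unique = unique-++⁻ʳ xs (unique p)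
    ; head≡  = refl
    ; last≡  = trans (sym (last-++ xs ys)) (last≡ p)
    }

  path-∷ : ∀ {s t xs} → IsPath s t xs → ∃ λ ys → xs ≡ s ∷ ys
  path-∷ {xs = x ∷ xs} p with head≡ p
  ... | refl = xs , refl

  loopless : ∀ {s xs} → IsPath s s xs → xs ≡ [ s ]
  loopless p with path-∷ p
  ... | []     , refl = refl
  ... | y ∷ ys , refl = ⊥-elim (unique-∷⇒∉ (unique p) (∈-last (y ∷ ys) (last≡ p)))

  walk⇒path : ∀ {P s t} → WalkIn G P s t → Σ (List (Fin n)) λ xs → IsPath s t xs × All P xs
  walk⇒path (here ps) = _ , singletonPath _ , ps ∷ []
  walk⇒path (step {s} ps s~w w⇝t) with walk⇒path w⇝t
  ... | xs , p , all with s ∈? xs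
  ...   | no s∉  = s ∷ xs , consPath s~w s∉ p , ps ∷ all
  ...   | yes s∈ with ∈-∃++ s∈
  ...     | ys , zs , refl = s ∷ zs , suffixPath ys p , Allₚ.++⁻ʳ ys all

  toPath : ∀ {x xs} → Linked (Adj G) (x ∷ xs) → Path G (x ∷ xs)
  toPath [-]     = single
  toPath (r ∷ l) = cons r (toPath l)

  -- No length bound: r ∷ [ c ] with r ~ c qualifies, so users add a parity or length condition.
  record IsClosedPath (r : Fin n) (cs : List (Fin n)) : Set where
    field
      end    : Fin n
      isPath : IsPath r end (r ∷ cs)
      closes : Adj G end r

  twoPaths⇒closedPath : ∀ {h w xs ys} → IsPath h w (h ∷ xs ++ [ w ]) → IsPath h w (h ∷ ys ++ [ w ]) →
                      Disjoint (h ∷ xs ++ [ w ]) ys → IsClosedPath h (xs ++ w ∷ reverse ys)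
  twoPaths⇒closedPath {ys = []} p q _ = record
    { end = _ ; isPath = p ; closes = Graph.sym G (Linked.head (linked q)) }
  twoPaths⇒closedPath {h} {w} {xs} {y ∷ ys} p q disj = record
    { end    = y
    ; isPath = subst (IsPath h y) (++-assoc (h ∷ xs) [ w ] (reverse (y ∷ ys))) (glue p back disj′)
    ; closes = Graph.sym G (Linked.head (linked q))
    }
    where
    back : IsPath w y (w ∷ reverse (y ∷ ys))
    back = subst (IsPath w y) (reverse-++ (y ∷ ys) [ w ]) (reversePath (suffixPath [ h ] q))
    disj′ : Disjoint (h ∷ xs ++ [ w ]) (reverse (y ∷ ys))
    disj′ (x∈p , x∈back) = disj (x∈p , reverse⁻ x∈back)

  record EvenCycleThrough (u v : Fin n) : Set where
    field
      rest   : List (Fin n)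
      cycle  : IsClosedPath u (v ∷ rest)
      long   : 3 ≤ length (u ∷ v ∷ rest)
      even   : parity (length (u ∷ v ∷ rest)) ≡ 0ℙ

  evenCycle : ∀ {u v} → EvenCycleThrough u v → Σ (Cycle G) λ C → EdgeOf u v C × Even (cycleLength C)
  evenCycle {u} {v} c = C , inj₁ (inj₁ now) , parity≡0ℙ⇒Even _ even
    where
    open EvenCycleThrough c using (rest; cycle; long; even)
    open IsClosedPath cycle using (end; isPath; closes)
    last-∷ : ∀ x xs → last (x ∷ xs) ≡ just (Defs.last x xs)
    last-∷ x []       = refl
    last-∷ x (y ∷ ys) = last-∷ y ys
    end≡last : end ≡ Defs.last u (v ∷ rest)
    end≡last = just-injective (trans (sym (last≡ isPath)) (last-∷ u (v ∷ rest)))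
    C : Cycle G
    C = record
      { start    = u
      ; rest     = v ∷ rest
      ; distinct = unique isPath
      ; long     = long
      ; path     = toPath (linked isPath)
      ; closing  = subst (λ e → Adj G e u) end≡last closes
      }

  oddPath⇒evenCycle : ∀ {u v x X} → Adj G u v → IsPath v x X → u ∉ X → Adj G x u → x ≢ v →
                      parity (length X) ≡ 1ℙ → EvenCycleThrough u v
  oddPath⇒evenCycle {u} {v} {x} u~v pX u∉X x~u x≢v odd with path-∷ pX
  ... | [] , refl with last≡ pX
  ...   | refl = ⊥-elim (x≢v refl)
  oddPath⇒evenCycle {u} {v} {x} u~v pX u∉X x~u x≢v odd | y ∷ X′ , refl = record
    { rest = y ∷ X′
    ; cycle = record { end = x ; isPath = consPath u~v u∉X pX ; closes = x~u }
    ; long = s≤s (s≤s (s≤s z≤n))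
    ; even = trans (parity-suc (length (v ∷ y ∷ X′))) (cong _⁻¹ odd)
    }

  record Lollipop (v : Fin n) : Set where
    field
      stem      : List (Fin n)
      root      : Fin n
      loop      : List (Fin n)
      stemPath  : IsPath v root stem
      cycle     : IsClosedPath root loop
      stem∩loop : Disjoint stem loop
      oddCycle  : parity (length (root ∷ loop)) ≡ 1ℙ

    vertices : List (Fin n)
    vertices = stem ++ loop

  open Lollipop using (vertices)

  oddClosedPath⇒lollipop : ∀ {h cs} → IsClosedPath h cs → parity (length (h ∷ cs)) ≡ 1ℙ → Lollipop h
  oddClosedPath⇒lollipop {h} {cs} c odd = record
    { stem = [ h ] ; root = h ; loop = cs ; stemPath = singletonPath h ; cycle = c
    ; stem∩loop = λ { (here refl , h∈cs) → unique-∷⇒∉ (unique (IsClosedPath.isPath c)) h∈cs }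
    ; oddCycle = odd }

  extendStem : ∀ {s w xs} → IsPath s w xs → (L : Lollipop w) →
               (∀ {x} → x ∈ xs → x ∈ vertices L → x ≡ w) →
               Σ (Lollipop s) λ L′ → vertices L′ ⊆ xs ++ vertices L
  extendStem p record { stem = [] ; stemPath = sp } _ with head≡ sp
  ... | ()
  extendStem {w = w} {xs} p L@record { stem = _ ∷ ts ; stemPath = sp ; stem∩loop = d } meets
    with head≡ sp
  ... | refl = L′ , L′⊆
    where
    open Lollipop L using (root; loop; cycle; oddCycle)
    disj₁ : Disjoint xs ts
    disj₁ (x∈xs , x∈ts) with meets x∈xs (there (∈-++⁺ˡ x∈ts))
    ... | refl = unique-∷⇒∉ (unique sp) x∈ts
    disj₂ : Disjoint (xs ++ ts) loop
    disj₂ (x∈ , x∈loop) with ∈-++⁻ xs x∈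
    ... | inj₁ x∈xs = d (here (meets x∈xs (∈-++⁺ʳ (w ∷ ts) x∈loop)) , x∈loop)
    ... | inj₂ x∈ts = d (there x∈ts , x∈loop)
    L′ : Lollipop _
    L′ = record
      { stem = xs ++ ts ; root = root ; loop = loop ; stemPath = glue p sp disj₁
      ; cycle = cycle ; stem∩loop = disj₂ ; oddCycle = oddCycle }
    L′⊆ : vertices L′ ⊆ xs ++ vertices L
    L′⊆ x∈ = ⊆ₚ.++⁺ʳ xs (⊆ₚ.xs⊆x∷xs _ w) (subst (_ ∈_) (++-assoc xs ts loop) x∈)

  data Meeting (h : Fin n) : List (Fin n) → List (Fin n) → Set where
    meet : ∀ a₁ w a₂ b₁ b₂ → All (_∉ h ∷ b₁ ++ w ∷ b₂) a₁ →
           Meeting h (h ∷ a₁ ++ w ∷ a₂) (h ∷ b₁ ++ w ∷ b₂)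

  meeting : ∀ {h y A B} → IsPath h y A → IsPath h y B → y ≢ h → Meeting h A B
  meeting {h} {y} pA pB y≢h with path-∷ pA | path-∷ pB
  ... | A′ , refl | B′ , refl
    with toView (Any⇒First (_∈? h ∷ B′) (Any.map (λ y≡x → subst (_∈ h ∷ B′) y≡x y∈B) y∈A′))
    where
    y∈A′ : y ∈ A′
    y∈A′ = ∈-last-∷ A′ (last≡ pA) y≢h
    y∈B : y ∈ h ∷ B′
    y∈B = ∈-last (h ∷ B′) (last≡ pB)
  ... | First._++_∷_ {a₁} {w} a₁∉B (here w≡h) a₂ =
    ⊥-elim (unique-∷⇒∉ (unique pA) (∈-++⁺ʳ a₁ (here (sym w≡h))))
  ... | First._++_∷_ {a₁} {w} a₁∉B (there w∈B′) a₂ with ∈-∃++ w∈B′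
  ...   | b₁ , b₂ , refl = meet a₁ w a₂ b₁ b₂ a₁∉B

  module _ {h y w a₁ a₂ b₁ b₂} (pA : IsPath h y (h ∷ a₁ ++ w ∷ a₂)) (pB : IsPath h y (h ∷ b₁ ++ w ∷ b₂))
           (a₁∉B : All (_∉ h ∷ b₁ ++ w ∷ b₂) a₁) where

    meetingCycle : IsClosedPath h (a₁ ++ w ∷ reverse b₁)
    meetingCycle = twoPaths⇒closedPath (prefixPath (h ∷ a₁) pA) (prefixPath (h ∷ b₁) pB) disj
      where
      disj : Disjoint (h ∷ a₁ ++ [ w ]) b₁
      disj (x∈ , x∈b₁) with ∈-++⁻ (h ∷ a₁) x∈
      ... | inj₁ (here refl)  = unique-∷⇒∉ (unique pB) (∈-++⁺ˡ x∈b₁)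
      ... | inj₁ (there x∈a₁) = All.lookup a₁∉B x∈a₁ (there (∈-++⁺ˡ x∈b₁))
      ... | inj₂ (here refl)  = unique-++⇒disjoint b₁ (unique-++⁻ʳ [ h ] (unique pB)) (x∈b₁ , here refl)

    meetingCycle-⊆ : h ∷ a₁ ++ w ∷ reverse b₁ ⊆ (h ∷ a₁ ++ w ∷ a₂) ++ (h ∷ b₁ ++ w ∷ b₂)
    meetingCycle-⊆ (here refl) = here refl
    meetingCycle-⊆ (there x∈) with ∈-++⁻ a₁ x∈
    ... | inj₁ x∈a₁              = there (∈-++⁺ˡ (∈-++⁺ˡ x∈a₁))
    ... | inj₂ (here refl)       = there (∈-++⁺ˡ (∈-++⁺ʳ a₁ (here refl)))
    ... | inj₂ (there x∈b₁)      = ∈-++⁺ʳ (h ∷ a₁ ++ w ∷ a₂) (there (∈-++⁺ˡ (reverse⁻ {xs = b₁} x∈b₁)))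

    prefix-meets-suffixes : ∀ {x} → x ∈ h ∷ a₁ ++ [ w ] → x ∈ (w ∷ a₂) ++ (w ∷ b₂) → x ≡ w
    prefix-meets-suffixes x∈pre x∈suf with ∈-++⁻ (h ∷ a₁) x∈pre
    ... | inj₂ (here x≡w) = x≡w
    ... | inj₁ x∈ha₁ with ∈-++⁻ (w ∷ a₂) x∈suf
    ...   | inj₁ x∈wa₂ = ⊥-elim (unique-++⇒disjoint (h ∷ a₁) (unique pA) (x∈ha₁ , x∈wa₂))
    ...   | inj₂ x∈wb₂ with x∈ha₁
    ...     | here refl  = ⊥-elim (unique-++⇒disjoint (h ∷ b₁) (unique pB) (here refl , x∈wb₂))
    ...     | there x∈a₁ = ⊥-elim (All.lookup a₁∉B x∈a₁ (∈-++⁺ʳ (h ∷ b₁) x∈wb₂))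

    extension-⊆ : (h ∷ a₁ ++ [ w ]) ++ (w ∷ a₂) ++ (w ∷ b₂) ⊆ (h ∷ a₁ ++ w ∷ a₂) ++ (h ∷ b₁ ++ w ∷ b₂)
    extension-⊆ x∈ with ∈-++⁻ (h ∷ a₁ ++ [ w ]) x∈
    ... | inj₂ x∈suf with ∈-++⁻ (w ∷ a₂) x∈suf
    ...   | inj₁ x∈wa₂ = ∈-++⁺ˡ (∈-++⁺ʳ (h ∷ a₁) x∈wa₂)
    ...   | inj₂ x∈wb₂ = ∈-++⁺ʳ (h ∷ a₁ ++ w ∷ a₂) (∈-++⁺ʳ (h ∷ b₁) x∈wb₂)
    extension-⊆ x∈ | inj₁ x∈pre with ∈-++⁻ (h ∷ a₁) x∈pre
    ...   | inj₁ x∈ha₁       = ∈-++⁺ˡ (∈-++⁺ˡ x∈ha₁)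
    ...   | inj₂ (here refl) = ∈-++⁺ˡ (∈-++⁺ʳ (h ∷ a₁) (here refl))

  -- Follow A until it first returns to B, at w. The two h–w segments close up; if that closed
  -- path is even, the w–y remainders of A and B have lengths of opposite parity and we recurse.
  twoPaths⇒lollipop : ∀ {h y A B} → IsPath h y A → IsPath h y B → parity (length A + length B) ≡ 1ℙ →
                Σ (Lollipop h) λ L → vertices L ⊆ A ++ B
  twoPaths⇒lollipop = go (<-wellFounded _)
    where
    go : ∀ {h y A B} → Acc _<_ (length A) → IsPath h y A → IsPath h y B →
         parity (length A + length B) ≡ 1ℙ → Σ (Lollipop h) λ L → vertices L ⊆ A ++ B
    go {h} {y} _ pA pB odd with y ≟ h
    go _ pA pB odd | yes refl with loopless pA | loopless pB | odd
    ... | refl | refl | ()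
    go {h} (acc shorter) pA pB odd | no y≢h with meeting pA pB y≢h
    ... | meet a₁ w a₂ b₁ b₂ a₁∉B
      with parity-+≡1ℙ (length (h ∷ a₁ ++ w ∷ reverse b₁)) (length (w ∷ a₂) + length (w ∷ b₂))
             (subst (λ m → parity m ≡ 1ℙ) (meeting-length h w a₁ a₂ b₁ b₂) odd)
    ...   | inj₁ oddCycle =
      oddClosedPath⇒lollipop (meetingCycle pA pB a₁∉B) oddCycle , meetingCycle-⊆ pA pB a₁∉B
    ...   | inj₂ oddRest
      with go (shorter (length-suffix< h a₁ (w ∷ a₂))) (suffixPath (h ∷ a₁) pA) (suffixPath (h ∷ b₁) pB) oddRest
    ...     | L , L⊆
      with extendStem (prefixPath (h ∷ a₁) pA) L (λ x∈ x∈L → prefix-meets-suffixes pA pB a₁∉B x∈ (L⊆ x∈L))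
    ...       | L′ , L′⊆ = L′ , λ x∈ → extension-⊆ pA pB a₁∉B (⊆ₚ.++⁺ʳ _ L⊆ (L′⊆ x∈))

  adjacentEnds⇒lollipop : ∀ {v x y X Y} → IsPath v x X → IsPath v y Y → Adj G x y →
                          parity (length X + length Y) ≡ 0ℙ → Σ (Lollipop v) λ L → vertices L ⊆ X ++ Y
  adjacentEnds⇒lollipop {v} {x} {y} {X} {Y} pX pY x~y even with y ∈? X
  ... | no y∉X with twoPaths⇒lollipop pXy pY odd
    where
    x∉[y] : x ∉ [ y ]
    x∉[y] (here refl) = Graph.irrefl G x~y
    pXy : IsPath v y (X ++ [ y ])
    pXy = glue pX (consPath x~y x∉[y] (singletonPath y)) λ { (y∈X , here refl) → y∉X y∈X }
    odd : parity (length (X ++ [ y ]) + length Y) ≡ 1ℙ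
    odd = subst (λ m → parity (m + length Y) ≡ 1ℙ) (sym (trans (length-++ X) (+-comm (length X) 1)))
            (trans (parity-suc (length X + length Y)) (cong _⁻¹ even))
  ...   | L , L⊆ = L , λ z∈ → ⊆-drop (L⊆ z∈)
    where
    ⊆-drop : (X ++ [ y ]) ++ Y ⊆ X ++ Y
    ⊆-drop z∈ with ∈-++⁻ (X ++ [ y ]) z∈
    ... | inj₂ z∈Y = ∈-++⁺ʳ X z∈Y
    ... | inj₁ z∈Xy with ∈-++⁻ X z∈Xy
    ...   | inj₁ z∈X       = ∈-++⁺ˡ z∈X
    ...   | inj₂ (here refl) = ∈-++⁺ʳ X (∈-last Y (last≡ pY))
  adjacentEnds⇒lollipop {v} {x} {y} {X} {Y} pX pY x~y even | yes y∈X with ∈-∃++ y∈X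
  ... | s , t , refl with parity (length (y ∷ t)) in cycle-parity
  ...   | 1ℙ = L , L⊆
    where
    L : Lollipop v
    L = record
      { stem = s ++ [ y ] ; root = y ; loop = t ; stemPath = prefixPath s pX
      ; cycle = record { end = x ; isPath = suffixPath s pX ; closes = x~y }
      ; stem∩loop = unique⇒prefix∩suffix s (unique pX)
      ; oddCycle = cycle-parity }
    L⊆ : vertices L ⊆ (s ++ y ∷ t) ++ Y
    L⊆ z∈ = ∈-++⁺ˡ (subst (_ ∈_) (++-assoc s [ y ] t) z∈)
  ...   | 0ℙ with twoPaths⇒lollipop (prefixPath s pX) pY odd
    where
    odd : parity (length (s ++ [ y ]) + length Y) ≡ 1ℙ
    odd with parity-+≡1ℙ (length (s ++ [ y ]) + length Y) (length (y ∷ t))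
               (subst (λ m → parity m ≡ 1ℙ) (sym (split-length s {y} t (length Y)))
                 (trans (parity-suc (length (s ++ y ∷ t) + length Y)) (cong _⁻¹ even)))
    ... | inj₁ odd′ = odd′
    ... | inj₂ odd′ = ⊥-elim (p≢p⁻¹ 0ℙ (trans (sym cycle-parity) odd′))
  ...     | L , L⊆ = L , λ z∈ → ⊆ₚ.++⁺ˡ Y (prefix-⊆ s t) (L⊆ z∈)

  -- With loop = c₁ ++ b ∷ c₂, the arcs r ∷ c₁ ++ [ b ] and r ∷ reverse c₂ ++ [ b ] have inner
  -- lengths of opposite parity because the cycle is odd.
  arcOfParity : ∀ {r b loop} → IsClosedPath r loop → parity (length (r ∷ loop)) ≡ 1ℙ → b ∈ loop →
                (p : Parity) → Σ (List (Fin n)) λ inner →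
                IsPath r b (r ∷ inner ++ [ b ]) × inner ⊆ loop × parity (length inner) ≡ p
  arcOfParity {r} {b} c odd b∈ p with ∈-∃++ b∈
  ... | c₁ , c₂ , refl with parity (length c₁) ℙ≟ p
  ...   | yes c₁≡p = c₁ , prefixPath (r ∷ c₁) (IsClosedPath.isPath c) , ∈-++⁺ˡ , c₁≡p
  ...   | no  c₁≢p = reverse c₂ , arc , (λ x∈ → ∈-++⁺ʳ c₁ (there (reverse⁻ x∈))) , c₂≡p
    where
    open IsClosedPath c
    r∉ : r ∉ reverse (b ∷ c₂)
    r∉ r∈ = unique-∷⇒∉ (unique isPath) (∈-++⁺ʳ c₁ (reverse⁻ r∈))
    arc : IsPath r b (r ∷ reverse c₂ ++ [ b ])
    arc = subst (λ xs → IsPath r b (r ∷ xs)) (unfold-reverse b c₂)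
            (consPath (Graph.sym G closes) r∉ (reversePath (suffixPath (r ∷ c₁) isPath)))
    c₁c₂-odd : parity (length c₁ + length c₂) ≡ 1ℙ
    c₁c₂-odd = subst (λ m → parity (suc m) ≡ 1ℙ) (trans (length-++ c₁) (+-suc _ _)) odd
    c₂≡p : parity (length (reverse c₂)) ≡ p
    c₂≡p = subst (λ m → parity m ≡ p) (sym (length-reverse c₂))
             (other-parity (parity (length c₁)) (parity (length c₂)) p
               (trans (sym (+-homo-+ (length c₁) (length c₂))) c₁c₂-odd) c₁≢p)

  closeThroughArc : ∀ {z r b X mid loop} → IsPath z r (z ∷ X) → IsClosedPath r loop →
    parity (length (r ∷ loop)) ≡ 1ℙ → b ∈ loop → IsPath z b (z ∷ mid ++ [ b ]) →
    Disjoint (z ∷ X) loop → Disjoint (z ∷ X) mid → Disjoint loop mid → (p : Parity) →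
    Σ (List (Fin n)) λ inner → inner ⊆ loop × IsClosedPath z ((X ++ inner) ++ b ∷ reverse mid) ×
      parity (length (z ∷ (X ++ inner) ++ b ∷ reverse mid)) ≡ p
  closeThroughArc {z} {r} {b} {X} {mid} {loop} pZ c odd b∈ segment X∩loop X∩mid loop∩mid p
    with arcOfParity c odd b∈ (p ℙ.+ parity (length X + length mid))
  ... | inner , arc , inner⊆ , inner-parity = inner , inner⊆ , closed , closed-parity
    where
    q : Parity
    q = parity (length X + length mid)
    closed-parity : parity (length (z ∷ (X ++ inner) ++ b ∷ reverse mid)) ≡ p
    closed-parity = begin
      parity (suc (length ((X ++ inner) ++ b ∷ reverse mid)))
        ≡⟨ cong (λ m → parity (suc m)) (arc-length X inner mid) ⟩
      parity (length inner + (length X + length mid))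
        ≡⟨ +-homo-+ (length inner) _ ⟩
      parity (length inner) ℙ.+ q
        ≡⟨ cong (ℙ._+ q) inner-parity ⟩
      p ℙ.+ q ℙ.+ q
        ≡⟨ p+q+q≡p p q ⟩
      p ∎
      where open ≡-Reasoning
    inner-b⊆loop : inner ++ [ b ] ⊆ loop
    inner-b⊆loop x∈ with ∈-++⁻ inner x∈
    ... | inj₁ x∈inner  = inner⊆ x∈inner
    ... | inj₂ (here refl) = b∈
    toArc : IsPath z b (z ∷ (X ++ inner) ++ [ b ])
    toArc = subst (λ xs → IsPath z b (z ∷ xs)) (sym (++-assoc X inner [ b ]))
              (glue pZ arc (disjoint-⊆ id inner-b⊆loop X∩loop))
    disj : Disjoint (z ∷ (X ++ inner) ++ [ b ]) mid
    disj = subst (λ xs → Disjoint (z ∷ xs) mid) (sym (++-assoc X inner [ b ]))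
             (disjoint-++ (z ∷ X) X∩mid (disjoint-⊆ inner-b⊆loop id loop∩mid))
    closed : IsClosedPath z ((X ++ inner) ++ b ∷ reverse mid)
    closed = twoPaths⇒closedPath toArc segment disj

  record Shortcut {v} (u : Fin n) (L : Lollipop v) : Set where
    field
      from to       : Fin n
      mid           : List (Fin n)
      from∈         : from ∈ u ∷ Lollipop.stem L
      from≢root     : from ≢ Lollipop.root L
      to∈           : to ∈ Lollipop.loop L
      segment       : IsPath from to (from ∷ mid ++ [ to ])
      stem∩mid      : Disjoint (u ∷ Lollipop.stem L) mid
      loop∩mid      : Disjoint (Lollipop.loop L) mid

  -- A u–c₀ path Q in G − root, c₀ the successor of root on the cycle, must pass from u ∷ stem
  -- to the loop; a passage with no intermediate stop on either gives the shortcut.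
  shortcut : ∀ {u v} → (∀ x → ConnectedWithout G x) → (L : Lollipop v) → u ∉ vertices L → Shortcut u L
  shortcut _ record { loop = [] ; cycle = record { isPath = p ; closes = end~root } } _ with last≡ p
  ... | refl = ⊥-elim (Graph.irrefl G end~root)
  shortcut {u} cw L@record { stem = stem ; root = root ; loop = c₀ ∷ cs ; stemPath = sp ; cycle = c } u∉L
    with walk⇒path (cw root u c₀ u≢root c₀≢root)
    where
    u≢root : u ≢ root
    u≢root refl = u∉L (∈-++⁺ˡ (∈-last stem (last≡ sp)))
    c₀≢root : c₀ ≢ root
    c₀≢root refl = unique-∷⇒∉ (unique (IsClosedPath.isPath c)) (here refl)
  ... | Q , pQ , Q≢root with path-∷ pQ
  ... | Q′ , refl with bridge (_∈? u ∷ stem) (_∈? c₀ ∷ cs) (here refl) c₀∈Q′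
    where
    c₀≢u : c₀ ≢ u
    c₀≢u refl = u∉L (∈-++⁺ʳ stem (here refl))
    c₀∈Q′ : Any (_∈ c₀ ∷ cs) Q′
    c₀∈Q′ = Any.map (λ c₀≡x → here (sym c₀≡x)) (∈-last-∷ Q′ (last≡ pQ) c₀≢u)
  ... | record { pre = pre ; mid = mid ; split = split ; from∈S = z∈ ; to∈T = b∈ ; mid-avoids = avoid } =
    record
      { from∈ = z∈ ; from≢root = All.lookup Q≢root z∈Q ; to∈ = b∈
      ; segment = prefixPath (_ ∷ mid) (suffixPath pre (subst (IsPath u c₀) split pQ))
      ; stem∩mid = λ (x∈ , x∈mid) → proj₁ (All.lookup avoid x∈mid) x∈
      ; loop∩mid = λ (x∈ , x∈mid) → proj₂ (All.lookup avoid x∈mid) x∈ }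
    where
    z∈Q : _ ∈ u ∷ Q′
    z∈Q = subst (_ ∈_) (sym split) (∈-++⁺ʳ pre (here refl))

  shortcut⇒evenCycle : ∀ {u v} → Adj G u v → (L : Lollipop v) → u ∉ vertices L → (sc : Shortcut u L) →
                       Shortcut.from sc ≡ u → EvenCycleThrough u v
  shortcut⇒evenCycle {u} u~v
    L@record { stem = stem ; stemPath = sp ; cycle = c ; stem∩loop = s∩l ; oddCycle = odd } u∉L
    record { to = b ; mid = mid ; to∈ = b∈ ; segment = seg ; stem∩mid = s∩m ; loop∩mid = l∩m } refl
    with path-∷ sp
  ... | stem′ , refl with closeThroughArc (consPath u~v u∉stem sp) c odd b∈ seg U∩loop s∩m l∩m 0ℙ
    where
    u∉stem : u ∉ stem
    u∉stem u∈ = u∉L (∈-++⁺ˡ u∈)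
    U∩loop : Disjoint (u ∷ stem) (Lollipop.loop L)
    U∩loop (here refl  , u∈loop) = u∉L (∈-++⁺ʳ stem u∈loop)
    U∩loop (there x∈stem , x∈loop) = s∩l (x∈stem , x∈loop)
  ... | inner , _ , closed , even = record
    { rest = (stem′ ++ inner) ++ b ∷ reverse mid
    ; cycle = closed
    ; long = s≤s (s≤s (0<length-++-∷ (stem′ ++ inner)))
    ; even = even
    }

  shortcut⇒shorterLollipop : ∀ {u v} (L : Lollipop v) → u ∉ vertices L → (sc : Shortcut u L) →
    Shortcut.from sc ∈ Lollipop.stem L →
    Σ (Lollipop v) λ L′ → u ∉ vertices L′ × length (Lollipop.stem L′) < length (Lollipop.stem L)
  shortcut⇒shorterLollipop {u}
    L@record { stem = stem ; loop = loop ; stemPath = sp ; cycle = c ; stem∩loop = s∩l ; oddCycle = odd } u∉L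
    record { from = z ; to = b ; mid = mid ; from≢root = z≢root ; to∈ = b∈ ; segment = seg
           ; stem∩mid = s∩m ; loop∩mid = l∩m } z∈stem
    with ∈-∃++ z∈stem
  ... | S₁ , S₂ , refl
    with closeThroughArc (suffixPath S₁ sp) c odd b∈ seg
           (disjoint-⊆ (∈-++⁺ʳ S₁) id s∩l) (disjoint-⊆ (there ∘ ∈-++⁺ʳ S₁) id s∩m) l∩m 1ℙ
  ... | inner , inner⊆ , closed , odd′ = L′ , u∉L′ , length-prefix< S₁ S₂ (last≡ sp) z≢root
    where
    loop′ : List (Fin n)
    loop′ = (S₂ ++ inner) ++ b ∷ reverse mid
    loop′⊆ : ∀ {x} → x ∈ loop′ → x ∈ S₂ ⊎ x ∈ loop ⊎ x ∈ mid
    loop′⊆ x∈ with ∈-++⁻ (S₂ ++ inner) x∈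
    ... | inj₂ (here refl)   = inj₂ (inj₁ b∈)
    ... | inj₂ (there x∈mid) = inj₂ (inj₂ (reverse⁻ x∈mid))
    ... | inj₁ x∈ with ∈-++⁻ S₂ x∈
    ...   | inj₁ x∈S₂    = inj₁ x∈S₂
    ...   | inj₂ x∈inner = inj₂ (inj₁ (inner⊆ x∈inner))
    stem′∩loop′ : Disjoint (S₁ ++ [ z ]) loop′
    stem′∩loop′ (x∈ , x∈loop′) with loop′⊆ x∈loop′
    ... | inj₁ x∈S₂          = unique⇒prefix∩suffix S₁ (unique sp) (x∈ , x∈S₂)
    ... | inj₂ (inj₁ x∈loop) = s∩l (prefix-⊆ S₁ S₂ x∈ , x∈loop)
    ... | inj₂ (inj₂ x∈mid)  = s∩m (there (prefix-⊆ S₁ S₂ x∈) , x∈mid)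
    L′ : Lollipop _
    L′ = record
      { stem = S₁ ++ [ z ] ; root = z ; loop = loop′ ; stemPath = prefixPath S₁ sp
      ; cycle = closed ; stem∩loop = stem′∩loop′ ; oddCycle = odd′ }
    u∉L′ : u ∉ vertices L′
    u∉L′ u∈ with ∈-++⁻ (S₁ ++ [ z ]) u∈
    ... | inj₁ u∈stem′ = u∉L (∈-++⁺ˡ (prefix-⊆ S₁ S₂ u∈stem′))
    ... | inj₂ u∈loop′ with loop′⊆ u∈loop′
    ...   | inj₁ u∈S₂          = u∉L (∈-++⁺ˡ (∈-++⁺ʳ S₁ (there u∈S₂)))
    ...   | inj₂ (inj₁ u∈loop) = u∉L (∈-++⁺ʳ (S₁ ++ z ∷ S₂) u∈loop)
    ...   | inj₂ (inj₂ u∈mid)  = s∩m (here refl , u∈mid)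

  lollipop⇒evenCycle : ∀ {u v} → (∀ x → ConnectedWithout G x) → Adj G u v →
                       (L : Lollipop v) → u ∉ vertices L → EvenCycleThrough u v
  lollipop⇒evenCycle {u} {v} cw u~v L = go L (<-wellFounded _)
    where
    go : (L : Lollipop v) → Acc _<_ (length (Lollipop.stem L)) → u ∉ vertices L → EvenCycleThrough u v
    go L (acc shorter) u∉L with shortcut cw L u∉L
    ... | sc with Shortcut.from∈ sc
    ...   | here z≡u     = shortcut⇒evenCycle u~v L u∉L sc z≡u
    ...   | there z∈stem with shortcut⇒shorterLollipop L u∉L sc z∈stem
    ...     | L′ , u∉L′ , lt = go L′ (shorter lt) u∉L′

module DegreeCounting {n} (G : Graph n) where

  A : Fin n → Fin n → ℕ
  A x y = 𝟙 (adj? G x y)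

  A-sym : ∀ x y → A x y ≡ A y x
  A-sym x y with adj? G x y | adj? G y x
  ... | yes _   | yes _   = refl
  ... | no  _   | no  _   = refl
  ... | yes x~y | no ¬y~x = ⊥-elim (¬y~x (Graph.sym G x~y))
  ... | no ¬x~y | yes y~x = ⊥-elim (¬x~y (Graph.sym G y~x))

  A≡1 : ∀ {x y} → Adj G x y → A x y ≡ 1
  A≡1 {x} {y} x~y with adj? G x y
  ... | yes _    = refl
  ... | no ¬x~y = ⊥-elim (¬x~y x~y)

  A≡0 : ∀ {x y} → ¬ Adj G x y → A x y ≡ 0
  A≡0 {x} {y} ¬x~y with adj? G x y
  ... | yes x~y = ⊥-elim (¬x~y x~y)
  ... | no _    = refl

  degree≡∑ : ∀ x → degree G x ≡ sum (A x)
  degree≡∑ x = length-filter-tabulate (adj? G x) (λ y → y)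

  module _ {k u v} (regular : Regular G k) (u~v : Adj G u v) (colour : Fin n → Parity)
           (proper : ∀ {x y} → x ≢ u → y ≢ u → Adj G x y → colour x ≢ colour y)
           (colour-v : colour v ≡ 1ℙ) (colour-N : ∀ {x} → Adj G u x → x ≢ v → colour x ≢ 1ℙ) where

    side : Parity → Fin n → ℕ
    side p x = 𝟙 (¬? (x ≟ u) ×-dec (colour x ℙ≟ p))

    side≡1 : ∀ {p x} → x ≢ u → colour x ≡ p → side p x ≡ 1
    side≡1 {p} {x} x≢u cx≡p with ¬? (x ≟ u) ×-dec (colour x ℙ≟ p)
    ... | yes _    = refl
    ... | no ¬both = ⊥-elim (¬both (x≢u , cx≡p))

    side≡0 : ∀ {p x} → ¬ (x ≢ u × colour x ≡ p) → side p x ≡ 0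
    side≡0 {p} {x} ¬both with ¬? (x ≟ u) ×-dec (colour x ℙ≟ p)
    ... | yes both = ⊥-elim (¬both both)
    ... | no _     = refl

    side-u : ∀ p → side p u ≡ 0
    side-u p = side≡0 λ (u≢u , _) → u≢u refl

    sides-cover : ∀ {x} → x ≢ u → side 1ℙ x + side 0ℙ x ≡ 1
    sides-cover {x} x≢u = by-colour (colour x ℙ≟ 1ℙ)
      where
      by-colour : Dec (colour x ≡ 1ℙ) → side 1ℙ x + side 0ℙ x ≡ 1
      by-colour (yes c≡1) = cong₂ _+_ (side≡1 x≢u c≡1) (side≡0 λ (_ , c≡0) → p≢p⁻¹ 0ℙ (trans (sym c≡0) c≡1))
      by-colour (no  c≢1) = cong₂ _+_ (side≡0 λ (_ , c≡1) → c≢1 c≡1) (side≡1 x≢u (≢⇒≡⁻¹ c≢1))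

    neighbours-across : ∀ {p x} → x ≢ u → colour x ≡ p → k ≡ A x u + sum (λ y → side (p ⁻¹) y * A x y)
    neighbours-across {p} {x} x≢u cx≡p = begin
      k                ≡⟨ sym (regular x) ⟩
      degree G x       ≡⟨ degree≡∑ x ⟩
      sum (A x)        ≡⟨ ∑-pick u (A x) (λ y → side (p ⁻¹) y * A x y) (cong (_* A x u) (side-u _)) across ⟩
      A x u + sum (λ y → side (p ⁻¹) y * A x y) ∎
      where
      open ≡-Reasoning
      across : ∀ y → y ≢ u → A x y ≡ side (p ⁻¹) y * A x y
      across y y≢u = by-adjacency (adj? G x y)
        where
        by-adjacency : Dec (Adj G x y) → A x y ≡ side (p ⁻¹) y * A x y
        by-adjacency (yes x~y) = trans (A≡1 x~y) (sym (cong₂ _*_ (side≡1 y≢u cy) (A≡1 x~y)))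
          where
          cy : colour y ≡ p ⁻¹
          cy = ≢⇒≡⁻¹ λ cy≡p → proper x≢u y≢u x~y (trans cx≡p (sym cy≡p))
        by-adjacency (no ¬x~y) =
          trans (A≡0 ¬x~y) (sym (trans (cong (side (p ⁻¹) y *_) (A≡0 ¬x~y)) (*-zeroʳ (side (p ⁻¹) y))))

    E : Parity → ℕ
    E p = sum λ x → sum λ y → side p x * (side (p ⁻¹) y * A x y)

    count : ∀ p → sum (side p) * k ≡ sum (λ x → side p x * A x u) + E p
    count p = begin
      sum (side p) * k
        ≡⟨ *-distribʳ-sum k (side p) ⟩
      sum (λ x → side p x * k)
        ≡⟨ sum-cong-≗ weighted ⟩
      sum (λ x → side p x * A x u + side p x * sum (λ y → side (p ⁻¹) y * A x y))
        ≡⟨ ∑-distrib-+ (λ x → side p x * A x u) _ ⟩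
      sum (λ x → side p x * A x u) + sum (λ x → side p x * sum (λ y → side (p ⁻¹) y * A x y))
        ≡⟨ cong (sum (λ x → side p x * A x u) +_) (sum-cong-≗ λ x → *-distribˡ-sum (side p x) (λ y → side (p ⁻¹) y * A x y)) ⟩
      sum (λ x → side p x * A x u) + E p ∎
      where
      open ≡-Reasoning
      weighted : ∀ x → side p x * k ≡ side p x * A x u + side p x * sum (λ y → side (p ⁻¹) y * A x y)
      weighted x = trans (by-side (¬? (x ≟ u) ×-dec (colour x ℙ≟ p))) (*-distribˡ-+ (side p x) _ _)
        where
        by-side : Dec (x ≢ u × colour x ≡ p) → side p x * k ≡ side p x * (A x u + sum (λ y → side (p ⁻¹) y * A x y))
        by-side (yes (x≢u , cx≡p)) = cong (side p x *_) (neighbours-across x≢u cx≡p)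
        by-side (no ¬both) rewrite side≡0 ¬both = refl

    E-sym : E 1ℙ ≡ E 0ℙ
    E-sym = trans (sum-cong-≗ λ x → sum-cong-≗ λ y → swap x y)
                  (sym (∑-comm λ x y → side 0ℙ x * (side 1ℙ y * A x y)))
      where
      left-comm : ∀ a b c → a * (b * c) ≡ b * (a * c)
      left-comm = solve-∀
      swap : ∀ x y → side 1ℙ x * (side 0ℙ y * A x y) ≡ side 0ℙ y * (side 1ℙ x * A y x)
      swap x y = trans (cong (λ m → side 1ℙ x * (side 0ℙ y * m)) (A-sym x y)) (left-comm (side 1ℙ x) (side 0ℙ y) (A y x))

    v≢u : v ≢ u
    v≢u = adj⇒≢ G (Graph.sym G u~v)

    odd-side-toward-u : sum (λ x → side 1ℙ x * A x u) ≡ 1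
    odd-side-toward-u = begin
      sum (λ x → side 1ℙ x * A x u)         ≡⟨ ∑-pick v (λ x → side 1ℙ x * A x u) (λ _ → 0) refl only-v ⟩
      side 1ℙ v * A v u + sum {n} (λ _ → 0) ≡⟨ cong₂ _+_ (cong₂ _*_ (side≡1 v≢u colour-v) (A≡1 (Graph.sym G u~v))) (sum-replicate-zero n) ⟩
      1 ∎
      where
      open ≡-Reasoning
      only-v : ∀ x → x ≢ v → side 1ℙ x * A x u ≡ 0
      only-v x x≢v = by-adjacency (adj? G x u)
        where
        by-adjacency : Dec (Adj G x u) → side 1ℙ x * A x u ≡ 0
        by-adjacency (yes x~u) = cong (_* A x u) (side≡0 λ (_ , cx≡1) → colour-N (Graph.sym G x~u) x≢v cx≡1)
        by-adjacency (no ¬x~u) = trans (cong (side 1ℙ x *_) (A≡0 ¬x~u)) (*-zeroʳ (side 1ℙ x))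

    both-sides-toward-u : sum (λ x → side 1ℙ x * A x u) + sum (λ x → side 0ℙ x * A x u) ≡ k
    both-sides-toward-u = begin
      sum (λ x → side 1ℙ x * A x u) + sum (λ x → side 0ℙ x * A x u)
        ≡⟨ sym (∑-distrib-+ (λ x → side 1ℙ x * A x u) _) ⟩
      sum (λ x → side 1ℙ x * A x u + side 0ℙ x * A x u)
        ≡⟨ sum-cong-≗ (λ x → by-vertex x (x ≟ u)) ⟩
      sum (A u)  ≡⟨ sym (degree≡∑ u) ⟩
      degree G u ≡⟨ regular u ⟩
      k ∎
      where
      open ≡-Reasoning
      by-vertex : ∀ x → Dec (x ≡ u) → side 1ℙ x * A x u + side 0ℙ x * A x u ≡ A u x
      by-vertex x (yes refl) =
        trans (cong₂ _+_ (cong (_* A u u) (side-u 1ℙ)) (cong (_* A u u) (side-u 0ℙ))) (sym (A≡0 (Graph.irrefl G)))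
      by-vertex x (no x≢u) = begin
        side 1ℙ x * A x u + side 0ℙ x * A x u ≡⟨ sym (*-distribʳ-+ (A x u) (side 1ℙ x) (side 0ℙ x)) ⟩
        (side 1ℙ x + side 0ℙ x) * A x u       ≡⟨ cong (_* A x u) (sides-cover x≢u) ⟩
        1 * A x u                             ≡⟨ *-identityˡ (A x u) ⟩
        A x u                                 ≡⟨ A-sym x u ⟩
        A u x                                 ∎

    -- With E the number of edges between the sides (E-sym), regularity gives
    -- k · |side 1ℙ| = 1 + E and k · |side 0ℙ| = (k − 1) + E.
    degree∣2 : k ∣ 2
    degree∣2 = ∣m+n∣m⇒∣n (subst (k ∣_) (sym key) (n∣m*n (suc T))) (n∣m*n F)
      where
      open ≡-Reasoning
      T F AF : ℕ
      T = sum (side 1ℙ)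
      F = sum (side 0ℙ)
      AF = sum (λ x → side 0ℙ x * A x u)
      rearrange : ∀ a e → a + e + 2 ≡ (1 + a) + (1 + e)
      rearrange = solve-∀
      key : F * k + 2 ≡ suc T * k
      key = begin
        F * k + 2             ≡⟨ cong (_+ 2) (count 0ℙ) ⟩
        AF + E 0ℙ + 2         ≡⟨ rearrange AF (E 0ℙ) ⟩
        (1 + AF) + (1 + E 0ℙ) ≡⟨ cong₂ _+_ (trans (cong (_+ AF) (sym odd-side-toward-u)) both-sides-toward-u)
                                          (sym (trans (count 1ℙ) (cong₂ _+_ odd-side-toward-u E-sym))) ⟩
        k + T * k             ∎

module _ {n} (G : Graph n) (cw : ∀ x → ConnectedWithout G x) {u v : Fin n} (u~v : Adj G u v) where

  open Paths G
  open DegreeCounting G using (degree∣2)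

  private
    v≢u : v ≢ u
    v≢u = adj⇒≢ G (Graph.sym G u~v)

    All≢⇒∉ : ∀ {xs} → All (_≢ u) xs → u ∉ xs
    All≢⇒∉ avoid u∈ = All.lookup avoid u∈ refl

  -- colour u is a junk value.
  colour : Fin n → Parity
  colour w with w ≟ u
  ... | yes _   = 0ℙ
  ... | no w≢u = parity (length (proj₁ (walk⇒path (cw u v w v≢u w≢u))))

  colourPath : ∀ w → w ≢ u → Σ (List (Fin n)) λ xs → IsPath v w xs × All (_≢ u) xs × parity (length xs) ≡ colour w
  colourPath w w≢u with w ≟ u
  ... | yes w≡u = ⊥-elim (w≢u w≡u)
  ... | no w≢u′ with walk⇒path (cw u v w v≢u w≢u′)
  ...   | xs , p , avoid = xs , p , avoid , refl

  colour-v : colour v ≡ 1ℙ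
  colour-v with colourPath v v≢u
  ... | V , pV , _ , c with loopless pV
  ...   | refl = sym c

  oddNeighbour⇒evenCycle : ∀ {x} → Adj G u x → x ≢ v → colour x ≡ 1ℙ → EvenCycleThrough u v
  oddNeighbour⇒evenCycle u~x x≢v odd with colourPath _ (adj⇒≢ G (Graph.sym G u~x))
  ... | X , pX , avoid , c = oddPath⇒evenCycle u~v pX (All≢⇒∉ avoid) (Graph.sym G u~x) x≢v (trans c odd)

  monochromaticEdge⇒evenCycle : ∀ {x y} → x ≢ u → y ≢ u → Adj G x y → colour x ≡ colour y →
                                EvenCycleThrough u v
  monochromaticEdge⇒evenCycle {x} {y} x≢u y≢u x~y same with colourPath x x≢u | colourPath y y≢u
  ... | X , pX , aX , cX | Y , pY , aY , cY with adjacentEnds⇒lollipop pX pY x~y even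
    where
    even : parity (length X + length Y) ≡ 0ℙ
    even = trans (+-homo-+ (length X) (length Y))
                 (trans (cong₂ ℙ._+_ (trans cX same) cY) (p+p≡0ℙ (colour y)))
  ...   | L , L⊆ = lollipop⇒evenCycle cw u~v L λ u∈L → All≢⇒∉ (Allₚ.++⁺ aX aY) (L⊆ u∈L)

  evenCycleThrough : ∀ {k} → 3 ≤ k → Regular G k → EvenCycleThrough u v
  evenCycleThrough 3≤k regular with any? (λ x → adj? G u x ×-dec (¬? (x ≟ v) ×-dec (colour x ℙ≟ 1ℙ)))
  ... | yes (_ , u~x , x≢v , odd) = oddNeighbour⇒evenCycle u~x x≢v odd
  ... | no ¬oddNeighbour
    with any? (λ x → any? (λ y → ¬? (x ≟ u) ×-dec (¬? (y ≟ u) ×-dec (adj? G x y ×-dec (colour x ℙ≟ colour y)))))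
  ...   | yes (_ , _ , x≢u , y≢u , x~y , same) = monochromaticEdge⇒evenCycle x≢u y≢u x~y same
  evenCycleThrough 3≤k regular | no ¬oddNeighbour | no ¬monochromatic
    with ≤-trans 3≤k (∣⇒≤ (degree∣2 regular u~v colour proper colour-v colour-N))
    where
    proper : ∀ {x y} → x ≢ u → y ≢ u → Adj G x y → colour x ≢ colour y
    proper x≢u y≢u x~y same = ¬monochromatic (_ , _ , x≢u , y≢u , x~y , same)
    colour-N : ∀ {x} → Adj G u x → x ≢ v → colour x ≢ 1ℙ
    colour-N u~x x≢v odd = ¬oddNeighbour (_ , u~x , x≢v , odd)
  ... | s≤s (s≤s ())

corollary2 : ∀ {n} (G : Graph n) (k : ℕ) → 3 ≤ k → Regular G k → TwoConnected G →
    ∀ u v → Adj G u v → Σ (Cycle G) (λ C → EdgeOf u v C × Even (cycleLength C))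
corollary2 G k 3≤k regular (_ , _ , cw) u v u~v =
  Paths.evenCycle G (evenCycleThrough G cw u~v 3≤k regular)
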